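{- For every positive integer $n$, $$N(2,2,3,9;8n+6)=\frac35\,N(1,1,3,9;8n+6).$$
   Context: For positive integers $a,b,c,d$ and an integer $n\ge 0$, $N(a,b,c,d;n)$ denotes the number of $(x,y,z,w)\in\mathbb Z^4$ with $n=ax^2+by^2+cz^2+dw^2$. -}

module Defs where

open import Data.Nat using (ℕ; zero; suc; _+_; _*_)
open import Data.Integer as ℤ using (ℤ; +_; -[1+_])
open import Data.List using (List; []; _∷_; _++_; map; reverse; upTo; length; filter; concatMap)
open import Data.Nat using (_≟_)
open import Relation.Nullary.Decidable using (does)
open import Data.Bool using (if_then_else_)
open import Data.Nat.ListAction using (sum)

intRange : ℕ → List ℤ
intRange m = map (λ k → -[1+ k ]) (reverse (upTo m)) ++ map +_ (upTo (suc m))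

form : ℕ → ℕ → ℕ → ℕ → ℤ → ℤ → ℤ → ℤ → ℕ
form a b c d x y z w =
  a * (ℤ.∣ x ∣ * ℤ.∣ x ∣) + b * (ℤ.∣ y ∣ * ℤ.∣ y ∣)
    + c * (ℤ.∣ z ∣ * ℤ.∣ z ∣) + d * (ℤ.∣ w ∣ * ℤ.∣ w ∣)

-- For positive a,b,c,d every solution has |x|,|y|,|z|,|w| ≤ n, so it suffices
-- to count over the box [-n,n]⁴ (each tuple appears exactly once there).
N : ℕ → ℕ → ℕ → ℕ → ℕ → ℕ
N a b c d n =
  sum (map (λ x → sum (map (λ y → sum (map (λ z → sum (map (λ w →
      if does (form a b c d x y z w ≟ n) then 1 else 0)
    R)) R)) R)) R)
  where R = intRange n

module Submission where

-- Put m = 8n + 6.  Modulo 8, a solution of x² + y² + 3z² + 9w² = m either has all coordinates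
-- odd, or exactly one of the pairs (x, z), (y, z), (z, w) consists of even numbers differing
-- modulo 4 while the other two coordinates are odd; call these classes I, X, Y, W.  The
-- substitution (x, y) ↦ (x + y, x − y) identifies the solutions of 2x² + 2y² + 3z² + 9w² = m
-- with the solutions having x ≡ y (mod 2), that is with I ∪ W, and swapping x and y gives
-- |X| = |Y|.  On pairs of equal parity, ρ(a, b) = ((a + 3b)/2, (a − b)/2) preserves a² + 3b²
-- and maps the even pairs of a given norm onto half of the odd pairs of that norm, while
-- (a, b) ↦ (a, −b) exchanges the two halves; applied to (x, z) and to (z, w) this gives
-- |I| = 2|X| = 2|W|.  Hence N(1,1,3,9;m) = 5|X| and N(2,2,3,9;m) = 3|X|.

open import Data.Bool using (Bool; true; false; not; _∧_; _∨_; _xor_; if_then_else_; T)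
open import Data.Bool.Properties
  using (T-∧; xor-same; xor-assoc; xor-comm; true-xor; not-involutive; ∧-idem; ∧-identityʳ)
open import Data.Empty using (⊥-elim)
open import Data.Integer as ℤ using (ℤ; +_; -[1+_]; ∣_∣)
import Data.Integer.Properties as ℤ
open import Data.List using (List; []; _∷_; _++_; map; cartesianProduct; upTo; reverse)
open import Data.List.Properties using (map-cong; map-++; map-∘; reverse-upTo)
open import Data.List.Membership.Propositional using (_∈_; _∉_)
open import Data.List.Membership.Propositional.Properties
  using (∈-map⁺; ∈-map⁻; ∈-++⁺ˡ; ∈-++⁺ʳ; ∈-upTo⁺; ∈-downFrom⁺; ∈-cartesianProduct⁺)
open import Data.List.Relation.Binary.Disjoint.Propositional using (Disjoint)
open import Data.List.Relation.Unary.All as All using ()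
open import Data.List.Relation.Unary.AllPairs using (_∷_)
open import Data.List.Relation.Unary.Any using (here; there)
open import Data.List.Relation.Unary.Unique.Propositional using (Unique)
open import Data.List.Relation.Unary.Unique.Propositional.Properties
  using (map⁺; ++⁺; upTo⁺; downFrom⁺; cartesianProduct⁺)
open import Data.Nat as ℕ using (ℕ; zero; suc; _≤_; z≤n; s≤s)
open import Data.Nat.ListAction using (sum)
open import Data.Nat.ListAction.Properties using (sum-++)
import Data.Nat.Properties as ℕ
open import Data.Product using (_×_; _,_; proj₁; proj₂; ∃-syntax)
open import Data.Product.Properties using (≡-dec)
open import Function using (_∘_; case_of_; Equivalence)
open import Relation.Binary.Definitions using (DecidableEquality)
open import Relation.Binary.PropositionalEquality
open import Relation.Nullary using (Dec; yes)
open import Relation.Nullary.Decidable using (does; dec-true; dec-false)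

open import Defs

∧-elim : ∀ x {y} → T (x ∧ y) → T x × T y
∧-elim x = Equivalence.to T-∧

∧-intro : ∀ {x y} → T x → T y → T (x ∧ y)
∧-intro tx ty = Equivalence.from T-∧ (tx , ty)

∧-cong-when : ∀ x {y z} → (T x → y ≡ z) → x ∧ y ≡ x ∧ z
∧-cong-when false _ = refl
∧-cong-when true y≡z = y≡z _

T-does : ∀ {A : Set} (a? : Dec A) → T (does a?) → A
T-does (yes a) _ = a

does-T : ∀ {A : Set} (a? : Dec A) → A → T (does a?)
does-T a? a = subst T (sym (dec-true a? a)) _

module FiniteSums where

  open import Data.Nat using (_+_; _*_)
  open import Algebra.Properties.CommutativeSemigroup ℕ.+-commutativeSemigroup
    using (interchange)

  𝟙 : Bool → ℕ
  𝟙 b = if b then 1 else 0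

  𝟙-∧ : ∀ a b → 𝟙 (a ∧ b) ≡ 𝟙 a * 𝟙 b
  𝟙-∧ false b = refl
  𝟙-∧ true b = sym (ℕ.+-identityʳ (𝟙 b))

  𝟙-cong : ∀ {a b} → (T a → T b) → (T b → T a) → 𝟙 a ≡ 𝟙 b
  𝟙-cong {false} {false} _ _ = refl
  𝟙-cong {false} {true} _ b⇒a = case b⇒a _ of λ ()
  𝟙-cong {true} {false} a⇒b _ = case a⇒b _ of λ ()
  𝟙-cong {true} {true} _ _ = refl

  𝟙-absorbs : ∀ b {n} → (T b → n ≡ 1) → 𝟙 b ≡ 𝟙 b * n
  𝟙-absorbs false _ = refl
  𝟙-absorbs true n≡1 = sym (trans (ℕ.+-identityʳ _) (n≡1 _))

  module _ {A : Set} where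

    ∑ : List A → (A → ℕ) → ℕ
    ∑ xs f = sum (map f xs)

    syntax ∑ xs (λ x → e) = ∑[ x ∈ xs ] e

    ∑-cong : ∀ xs {f g : A → ℕ} → (∀ x → f x ≡ g x) → ∑ xs f ≡ ∑ xs g
    ∑-cong xs f≗g = cong sum (map-cong f≗g xs)

    ∑-++ : ∀ xs ys (f : A → ℕ) → ∑ (xs ++ ys) f ≡ ∑ xs f + ∑ ys f
    ∑-++ xs ys f = trans (cong sum (map-++ f xs ys)) (sum-++ (map f xs) (map f ys))

    ∑-zero : ∀ xs → ∑[ x ∈ xs ] 0 ≡ 0
    ∑-zero [] = refl
    ∑-zero (x ∷ xs) = ∑-zero xs

    ∑-+ : ∀ xs (f g : A → ℕ) → ∑[ x ∈ xs ] (f x + g x) ≡ ∑ xs f + ∑ xs g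
    ∑-+ [] f g = refl
    ∑-+ (x ∷ xs) f g = begin
      f x + g x + ∑[ x ∈ xs ] (f x + g x) ≡⟨ cong (_+_ (f x + g x)) (∑-+ xs f g) ⟩
      f x + g x + (∑ xs f + ∑ xs g)       ≡⟨ interchange (f x) (g x) (∑ xs f) (∑ xs g) ⟩
      f x + ∑ xs f + (g x + ∑ xs g)       ∎
      where open ≡-Reasoning

    ∑-*ˡ : ∀ xs k (f : A → ℕ) → ∑[ x ∈ xs ] (k * f x) ≡ k * ∑ xs f
    ∑-*ˡ [] k f = sym (ℕ.*-zeroʳ k)
    ∑-*ˡ (x ∷ xs) k f =
      trans (cong (_+_ (k * f x)) (∑-*ˡ xs k f)) (sym (ℕ.*-distribˡ-+ k (f x) (∑ xs f)))

  ∑-map : ∀ {A B : Set} xs (g : A → B) (f : B → ℕ) → ∑ (map g xs) f ≡ ∑ xs (f ∘ g)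
  ∑-map xs g f = cong sum (sym (map-∘ xs))

  module _ {A B : Set} where

    ∑-swap : ∀ xs ys (F : A → B → ℕ) →
             ∑[ x ∈ xs ] ∑[ y ∈ ys ] F x y ≡ ∑[ y ∈ ys ] ∑[ x ∈ xs ] F x y
    ∑-swap [] ys F = sym (∑-zero ys)
    ∑-swap (x ∷ xs) ys F =
      trans (cong (_+_ (∑ ys (F x))) (∑-swap xs ys F)) (sym (∑-+ ys (F x) _))

    ∑-cartesianProduct : ∀ xs ys (f : A × B → ℕ) →
                         ∑ (cartesianProduct xs ys) f ≡ ∑[ x ∈ xs ] ∑[ y ∈ ys ] f (x , y)
    ∑-cartesianProduct [] ys f = refl
    ∑-cartesianProduct (x ∷ xs) ys f = begin
      ∑ (map (x ,_) ys ++ cartesianProduct xs ys) f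
        ≡⟨ ∑-++ (map (x ,_) ys) _ f ⟩
      ∑ (map (x ,_) ys) f + ∑ (cartesianProduct xs ys) f
        ≡⟨ cong₂ _+_ (∑-map ys (x ,_) f) (∑-cartesianProduct xs ys f) ⟩
      ∑[ y ∈ ys ] f (x , y) + ∑[ x ∈ xs ] ∑[ y ∈ ys ] f (x , y) ∎
      where open ≡-Reasoning

  record SubsetBijection {A : Set} (P Q : A → Bool) : Set where
    field
      to      : A → A
      from    : A → A
      to∈     : ∀ {v} → T (P v) → T (Q (to v))
      from∈   : ∀ {u} → T (Q u) → T (P (from u))
      from-to : ∀ {v} → T (P v) → from (to v) ≡ v
      to-from : ∀ {u} → T (Q u) → to (from u) ≡ u

  module Counting {A : Set} (_≟_ : DecidableEquality A) where

    count : (A → Bool) → List A → ℕ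
    count P xs = ∑[ v ∈ xs ] 𝟙 (P v)

    count-cong : ∀ {P Q} xs → (∀ v → 𝟙 (P v) ≡ 𝟙 (Q v)) → count P xs ≡ count Q xs
    count-cong xs = ∑-cong xs

    count-+ : ∀ {P Q R} xs → (∀ v → 𝟙 (P v) ≡ 𝟙 (Q v) + 𝟙 (R v)) →
              count P xs ≡ count Q xs + count R xs
    count-+ {P} {Q} {R} xs split = trans (∑-cong xs split) (∑-+ xs (𝟙 ∘ Q) (𝟙 ∘ R))

    multiplicity : List A → A → ℕ
    multiplicity xs v = count (λ u → does (u ≟ v)) xs

    multiplicity-∉ : ∀ {xs v} → v ∉ xs → multiplicity xs v ≡ 0
    multiplicity-∉ {[]} v∉xs = refl
    multiplicity-∉ {x ∷ xs} {v} v∉xs rewrite dec-false (x ≟ v) (λ x≡v → v∉xs (here (sym x≡v))) =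
      multiplicity-∉ (v∉xs ∘ there)

    multiplicity-unique : ∀ {xs v} → Unique xs → v ∈ xs → multiplicity xs v ≡ 1
    multiplicity-unique {v ∷ xs} (v≢xs ∷ _) (here refl) rewrite dec-true (v ≟ v) refl =
      cong suc (multiplicity-∉ (λ v∈xs → All.lookup v≢xs v∈xs refl))
    multiplicity-unique {x ∷ xs} (x≢xs ∷ xs-unique) (there v∈xs)
      rewrite dec-false (x ≟ _) (All.lookup x≢xs v∈xs) = multiplicity-unique xs-unique v∈xs

    -- Both sides are double sums over the graph of the bijection: weight each v by the
    -- multiplicity (one) of to v in xs, swap the sums, and read the graph back through from.
    count-bijection : ∀ {xs P Q} → Unique xs →
                      (∀ {v} → T (P v) → v ∈ xs) → (∀ {v} → T (Q v) → v ∈ xs) →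
                      SubsetBijection P Q → count P xs ≡ count Q xs
    count-bijection {xs} {P} {Q} xs-unique P⊆xs Q⊆xs β = begin
      ∑[ v ∈ xs ] 𝟙 (P v)
        ≡⟨ ∑-cong xs (λ v → 𝟙-absorbs (P v) (once ∘ Q⊆xs ∘ to∈)) ⟩
      ∑[ v ∈ xs ] (𝟙 (P v) * multiplicity xs (to v))
        ≡⟨ ∑-cong xs (λ v → sym (∑-*ˡ xs (𝟙 (P v)) _)) ⟩
      ∑[ v ∈ xs ] ∑[ u ∈ xs ] (𝟙 (P v) * 𝟙 (does (u ≟ to v)))
        ≡⟨ ∑-swap xs xs _ ⟩
      ∑[ u ∈ xs ] ∑[ v ∈ xs ] (𝟙 (P v) * 𝟙 (does (u ≟ to v)))
        ≡⟨ ∑-cong xs (λ u → ∑-cong xs (graph-symmetric u)) ⟩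
      ∑[ u ∈ xs ] ∑[ v ∈ xs ] (𝟙 (Q u) * 𝟙 (does (v ≟ from u)))
        ≡⟨ ∑-cong xs (λ u → ∑-*ˡ xs (𝟙 (Q u)) _) ⟩
      ∑[ u ∈ xs ] (𝟙 (Q u) * multiplicity xs (from u))
        ≡⟨ ∑-cong xs (λ u → 𝟙-absorbs (Q u) (once ∘ P⊆xs ∘ from∈)) ⟨
      ∑[ u ∈ xs ] 𝟙 (Q u) ∎
      where
      open ≡-Reasoning
      open SubsetBijection β
      once : ∀ {v} → v ∈ xs → multiplicity xs v ≡ 1
      once = multiplicity-unique xs-unique
      graph-symmetric : ∀ u v → 𝟙 (P v) * 𝟙 (does (u ≟ to v)) ≡ 𝟙 (Q u) * 𝟙 (does (v ≟ from u))
      graph-symmetric u v = begin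
        𝟙 (P v) * 𝟙 (does (u ≟ to v))   ≡⟨ 𝟙-∧ (P v) _ ⟨
        𝟙 (P v ∧ does (u ≟ to v))       ≡⟨ 𝟙-cong forth back ⟩
        𝟙 (Q u ∧ does (v ≟ from u))     ≡⟨ 𝟙-∧ (Q u) _ ⟩
        𝟙 (Q u) * 𝟙 (does (v ≟ from u)) ∎
        where
        forth : T (P v ∧ does (u ≟ to v)) → T (Q u ∧ does (v ≟ from u))
        forth Pv∧u≡tov with Pv , u≡tov ← ∧-elim (P v) Pv∧u≡tov
                         with refl ← T-does (u ≟ to v) u≡tov =
          ∧-intro (to∈ Pv) (does-T (v ≟ from u) (sym (from-to Pv)))
        back : T (Q u ∧ does (v ≟ from u)) → T (P v ∧ does (u ≟ to v))
        back Qu∧v≡fromu with Qu , v≡fromu ← ∧-elim (Q u) Qu∧v≡fromu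
                         with refl ← T-does (v ≟ from u) v≡fromu =
          ∧-intro (from∈ Qu) (does-T (u ≟ to v) (sym (to-from Qu)))

open FiniteSums

module Solutions where

  open import Data.Nat using (_+_; _*_)

  V : Set
  V = ℤ × ℤ × ℤ × ℤ

  _≟ⱽ_ : DecidableEquality V
  _≟ⱽ_ = ≡-dec ℤ._≟_ (≡-dec ℤ._≟_ (≡-dec ℤ._≟_ ℤ._≟_))

  open Counting _≟ⱽ_ public

  intRange-unique : ∀ K → Unique (intRange K)
  intRange-unique K =
    ++⁺ (map⁺ ℤ.-[1+-injective downwards) (map⁺ ℤ.+-injective (upTo⁺ (suc K))) negatives-disjoint
    where
    downwards : Unique (reverse (upTo K))
    downwards = subst Unique (sym (reverse-upTo K)) (downFrom⁺ K)
    negatives-disjoint : Disjoint (map -[1+_] (reverse (upTo K))) (map +_ (upTo (suc K)))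
    negatives-disjoint (v∈negatives , v∈naturals)
      with ∈-map⁻ -[1+_] v∈negatives | ∈-map⁻ +_ v∈naturals
    ... | _ , _ , refl | _ , _ , ()

  ∈-intRange : ∀ {K} x → ∣ x ∣ ≤ K → x ∈ intRange K
  ∈-intRange (+ n) n≤K = ∈-++⁺ʳ _ (∈-map⁺ +_ (∈-upTo⁺ (s≤s n≤K)))
  ∈-intRange {K} -[1+ n ] n<K =
    ∈-++⁺ˡ (∈-map⁺ -[1+_] (subst (n ∈_) (sym (reverse-upTo K)) (∈-downFrom⁺ n<K)))

  box : ℕ → List V
  box K = cartesianProduct R (cartesianProduct R (cartesianProduct R R))
    where R = intRange K

  box-unique : ∀ K → Unique (box K)
  box-unique K = cartesianProduct⁺ R (cartesianProduct⁺ R (cartesianProduct⁺ R R))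
    where R = intRange-unique K

  ∈-box : ∀ {K} (v : V) → let (x , y , z , w) = v in
          ∣ x ∣ ≤ K → ∣ y ∣ ≤ K → ∣ z ∣ ≤ K → ∣ w ∣ ≤ K → v ∈ box K
  ∈-box (x , y , z , w) x≤K y≤K z≤K w≤K =
    ∈-cartesianProduct⁺ (∈-intRange x x≤K)
      (∈-cartesianProduct⁺ (∈-intRange y y≤K)
        (∈-cartesianProduct⁺ (∈-intRange z z≤K) (∈-intRange w w≤K)))

  Sol : ℕ → ℕ → ℕ → ℕ → ℕ → V → Bool
  Sol a b c d m (x , y , z , w) = does (form a b c d x y z w ℕ.≟ m)

  Sol⇒form : ∀ {a b c d m} (v : V) → T (Sol a b c d m v) →
             let (x , y , z , w) = v in form a b c d x y z w ≡ m
  Sol⇒form {a} {b} {c} {d} {m} (x , y , z , w) = T-does (form a b c d x y z w ℕ.≟ m)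

  N≡count : ∀ a b c d m → N a b c d m ≡ count (Sol a b c d m) (box m)
  N≡count a b c d m = sym (begin
    ∑ (cartesianProduct R (cartesianProduct R (cartesianProduct R R))) f
      ≡⟨ ∑-cartesianProduct R _ f ⟩
    ∑[ x ∈ R ] ∑ (cartesianProduct R (cartesianProduct R R)) (λ p → f (x , p))
      ≡⟨ ∑-cong R (λ x → trans (∑-cartesianProduct R _ _)
                           (∑-cong R (λ y → ∑-cartesianProduct R R _))) ⟩
    ∑[ x ∈ R ] ∑[ y ∈ R ] ∑[ z ∈ R ] ∑[ w ∈ R ] f (x , y , z , w) ∎)
    where
    open ≡-Reasoning
    R = intRange m
    f = λ v → 𝟙 (Sol a b c d m v)

  ≤-term : ∀ k t → t ≤ suc k * (t * t)
  ≤-term k zero = z≤n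
  ≤-term k t@(suc _) = ℕ.≤-trans (ℕ.m≤m*n t t) (ℕ.m≤n*m (t * t) (suc k))

  solution∈box : ∀ a b c d m {v} → T (Sol (suc a) (suc b) (suc c) (suc d) m v) → v ∈ box m
  solution∈box a b c d m {v@(x , y , z , w)} sol
    with refl ← Sol⇒form {suc a} {suc b} {suc c} {suc d} {m} v sol =
    ∈-box v
      (ℕ.≤-trans (≤-term a ∣ x ∣)
        (ℕ.≤-trans (ℕ.m≤m+n A B) (ℕ.≤-trans (ℕ.m≤m+n (A + B) C) (ℕ.m≤m+n (A + B + C) D))))
      (ℕ.≤-trans (≤-term b ∣ y ∣)
        (ℕ.≤-trans (ℕ.m≤n+m B A) (ℕ.≤-trans (ℕ.m≤m+n (A + B) C) (ℕ.m≤m+n (A + B + C) D))))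
      (ℕ.≤-trans (≤-term c ∣ z ∣) (ℕ.≤-trans (ℕ.m≤n+m C (A + B)) (ℕ.m≤m+n (A + B + C) D)))
      (ℕ.≤-trans (≤-term d ∣ w ∣) (ℕ.m≤n+m D (A + B + C)))
    where
    A = suc a * (∣ x ∣ * ∣ x ∣)
    B = suc b * (∣ y ∣ * ∣ y ∣)
    C = suc c * (∣ z ∣ * ∣ z ∣)
    D = suc d * (∣ w ∣ * ∣ w ∣)

open Solutions

module IntegerForm where

  open import Data.Integer using (_+_; _*_)
  open ≡-Reasoning

  Q : ℕ → ℕ → ℕ → ℕ → V → ℤ
  Q a b c d (x , y , z , w) = + a * (x * x) + + b * (y * y) + + c * (z * z) + + d * (w * w)

  +∣x∣²≡x² : ∀ x → + (∣ x ∣ ℕ.* ∣ x ∣) ≡ x * x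
  +∣x∣²≡x² (+ n) = sym (ℤ.+◃n≡+n (n ℕ.* n))
  +∣x∣²≡x² -[1+ n ] = sym (ℤ.+◃n≡+n (suc n ℕ.* suc n))

  +form≡Q : ∀ a b c d (v : V) → let (x , y , z , w) = v in + form a b c d x y z w ≡ Q a b c d v
  +form≡Q a b c d (x , y , z , w) = begin
    + (A ℕ.+ B ℕ.+ C ℕ.+ D)     ≡⟨ ℤ.pos-+ (A ℕ.+ B ℕ.+ C) D ⟩
    + (A ℕ.+ B ℕ.+ C) + + D     ≡⟨ cong (_+ + D) (ℤ.pos-+ (A ℕ.+ B) C) ⟩
    + (A ℕ.+ B) + + C + + D     ≡⟨ cong (λ t → t + + C + + D) (ℤ.pos-+ A B) ⟩
    + A + + B + + C + + D       ≡⟨ cong₂ _+_ (cong₂ _+_ (cong₂ _+_ (term a x) (term b y))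
                                                        (term c z))
                                             (term d w) ⟩
    Q a b c d (x , y , z , w)   ∎
    where
    A = a ℕ.* (∣ x ∣ ℕ.* ∣ x ∣)
    B = b ℕ.* (∣ y ∣ ℕ.* ∣ y ∣)
    C = c ℕ.* (∣ z ∣ ℕ.* ∣ z ∣)
    D = d ℕ.* (∣ w ∣ ℕ.* ∣ w ∣)
    term : ∀ k t → + (k ℕ.* (∣ t ∣ ℕ.* ∣ t ∣)) ≡ + k * (t * t)
    term k t = trans (ℤ.pos-* k _) (cong (+ k *_) (+∣x∣²≡x² t))

  Sol⇒Q : ∀ {a b c d m} v → T (Sol a b c d m v) → Q a b c d v ≡ + m
  Sol⇒Q {a} {b} {c} {d} {m} v sol =
    trans (sym (+form≡Q a b c d v)) (cong +_ (Sol⇒form {a} {b} {c} {d} {m} v sol))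

  Sol-resp : ∀ {a b c d a′ b′ c′ d′ m} v u → Q a b c d v ≡ Q a′ b′ c′ d′ u →
             Sol a b c d m v ≡ Sol a′ b′ c′ d′ m u
  Sol-resp {a} {b} {c} {d} {a′} {b′} {c′} {d′} {m} v u Qv≡Qu =
    cong (λ t → does (t ℕ.≟ m))
         (ℤ.+-injective (trans (+form≡Q a b c d v) (trans Qv≡Qu (sym (+form≡Q a′ b′ c′ d′ u)))))

open IntegerForm

module Parity where

  open import Data.Integer using (_+_; _*_; -_; _-_; 0ℤ)
  open import Data.Integer.Tactic.RingSolver using (solve-∀)
  open ≡-Reasoning

  bit : Bool → ℤ
  bit b = + 𝟙 b

  oddℕ : ℕ → Bool
  oddℕ zero = false
  oddℕ (suc zero) = true
  oddℕ (suc (suc n)) = oddℕ n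

  odd : ℤ → Bool
  odd (+ n) = oddℕ n
  odd -[1+ n ] = not (oddℕ n)

  -- Rounds towards -∞, so that the decomposition below also holds for negative x.
  half : ℤ → ℤ
  half (+ n) = + ℕ.⌊ n /2⌋
  half -[1+ n ] = -[1+ ℕ.⌊ n /2⌋ ]

  ℕ-decomposition : ∀ n → + n ≡ + 2 * + ℕ.⌊ n /2⌋ + bit (oddℕ n)
  ℕ-decomposition zero = refl
  ℕ-decomposition (suc zero) = refl
  ℕ-decomposition (suc (suc n)) = begin
    + 2 + + n                         ≡⟨ cong (_+_ (+ 2)) (ℕ-decomposition n) ⟩
    + 2 + (+ 2 * + h + bit (oddℕ n))  ≡⟨ step (+ h) (bit (oddℕ n)) ⟩
    + 2 * (+ 1 + + h) + bit (oddℕ n)  ∎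
    where
    h = ℕ.⌊ n /2⌋
    step : ∀ h c → + 2 + (+ 2 * h + c) ≡ + 2 * (+ 1 + h) + c
    step = solve-∀

  decomposition : ∀ x → x ≡ + 2 * half x + bit (odd x)
  decomposition (+ n) = ℕ-decomposition n
  decomposition -[1+ n ] = begin
    - (+ 1 + + n)                             ≡⟨ cong (λ t → - (+ 1 + t)) (ℕ-decomposition n) ⟩
    - (+ 1 + (+ 2 * + h + bit (oddℕ n)))      ≡⟨ negate (oddℕ n) (+ h) ⟩
    + 2 * - (+ 1 + + h) + bit (not (oddℕ n))  ∎
    where
    h = ℕ.⌊ n /2⌋
    negate : ∀ b h → - (+ 1 + (+ 2 * h + bit b)) ≡ + 2 * - (+ 1 + h) + bit (not b)
    negate false = solve-∀
    negate true = solve-∀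

  ∣2*∣≢1 : ∀ d → ∣ + 2 * d ∣ ≢ 1
  ∣2*∣≢1 d ∣2d∣≡1 = ℕ.even≢odd ∣ d ∣ 0 (trans (sym (ℤ.abs-* (+ 2) d)) ∣2d∣≡1)

  2*+bit-injective : ∀ {k l} b c → + 2 * k + bit b ≡ + 2 * l + bit c → b ≡ c × k ≡ l
  2*+bit-injective {k} {l} b c eq = compare b c (begin
    + 2 * (k - l)                            ≡⟨ expand k l (bit b) (bit c) ⟩
    (+ 2 * k + bit b) - y + (bit c - bit b)  ≡⟨ cong (λ t → t - y + (bit c - bit b)) eq ⟩
    y - y + (bit c - bit b)                  ≡⟨ cancel y (bit c - bit b) ⟩
    bit c - bit b                            ∎)
    where
    y = + 2 * l + bit c
    expand : ∀ k l p q → + 2 * (k - l) ≡ (+ 2 * k + p) - (+ 2 * l + q) + (q - p)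
    expand = solve-∀
    cancel : ∀ y e → y - y + e ≡ e
    cancel = solve-∀
    compare : ∀ b c → + 2 * (k - l) ≡ bit c - bit b → b ≡ c × k ≡ l
    compare false false 2d≡0 = refl , ℤ.i-j≡0⇒i≡j k l (ℤ.*-cancelˡ-≡ (+ 2) (k - l) 0ℤ 2d≡0)
    compare true true 2d≡0 = refl , ℤ.i-j≡0⇒i≡j k l (ℤ.*-cancelˡ-≡ (+ 2) (k - l) 0ℤ 2d≡0)
    compare false true 2d≡1 = ⊥-elim (∣2*∣≢1 (k - l) (cong ∣_∣ 2d≡1))
    compare true false 2d≡-1 = ⊥-elim (∣2*∣≢1 (k - l) (cong ∣_∣ 2d≡-1))

  odd-half-unique : ∀ {x} k b → x ≡ + 2 * k + bit b → odd x ≡ b × half x ≡ k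
  odd-half-unique {x} k b x≡2k+b =
    2*+bit-injective (odd x) b (trans (sym (decomposition x)) x≡2k+b)

  odd[2k+b]≡b : ∀ k b → odd (+ 2 * k + bit b) ≡ b
  odd[2k+b]≡b k b = proj₁ (odd-half-unique k b refl)

  half[2k+b]≡k : ∀ k b → half (+ 2 * k + bit b) ≡ k
  half[2k+b]≡k k b = proj₂ (odd-half-unique k b refl)

  bit-+ : ∀ p q → bit p + bit q ≡ + 2 * bit (p ∧ q) + bit (p xor q)
  bit-+ false false = refl
  bit-+ false true = refl
  bit-+ true false = refl
  bit-+ true true = refl

  bit-* : ∀ p q → bit p * bit q ≡ bit (p ∧ q)
  bit-* false false = refl
  bit-* false true = refl
  bit-* true false = refl
  bit-* true true = refl

  odd-+ : ∀ x y → odd (x + y) ≡ odd x xor odd y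
  odd-+ x y = proj₁ (odd-half-unique (h + bit (p ∧ q)) (p xor q) (begin
    x + y                                             ≡⟨ cong₂ _+_ (decomposition x)
                                                                   (decomposition y) ⟩
    (+ 2 * half x + bit p) + (+ 2 * half y + bit q)   ≡⟨ regroup (half x) (half y) (bit p) (bit q) ⟩
    + 2 * h + (bit p + bit q)                         ≡⟨ cong (_+_ (+ 2 * h)) (bit-+ p q) ⟩
    + 2 * h + (+ 2 * bit (p ∧ q) + bit (p xor q))     ≡⟨ carry h (bit (p ∧ q)) (bit (p xor q)) ⟩
    + 2 * (h + bit (p ∧ q)) + bit (p xor q)           ∎))
    where
    p = odd x
    q = odd y
    h = half x + half y
    regroup : ∀ h k b c → (+ 2 * h + b) + (+ 2 * k + c) ≡ + 2 * (h + k) + (b + c)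
    regroup = solve-∀
    carry : ∀ h c s → + 2 * h + (+ 2 * c + s) ≡ + 2 * (h + c) + s
    carry = solve-∀

  odd-* : ∀ x y → odd (x * y) ≡ odd x ∧ odd y
  odd-* x y = proj₁ (odd-half-unique k (p ∧ q) (begin
    x * y                                             ≡⟨ cong₂ _*_ (decomposition x)
                                                                   (decomposition y) ⟩
    (+ 2 * half x + bit p) * (+ 2 * half y + bit q)   ≡⟨ expand (half x) (half y) (bit p) (bit q) ⟩
    + 2 * k + bit p * bit q                           ≡⟨ cong (_+_ (+ 2 * k)) (bit-* p q) ⟩
    + 2 * k + bit (p ∧ q)                             ∎))
    where
    p = odd x
    q = odd y
    k = + 2 * half x * half y + half x * bit q + half y * bit p
    expand : ∀ h k b c → (+ 2 * h + b) * (+ 2 * k + c) ≡ + 2 * (+ 2 * h * k + h * c + k * b) + b * c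
    expand = solve-∀

  odd-neg : ∀ x → odd (- x) ≡ odd x
  odd-neg x = proj₁ (odd-half-unique (- half x - bit (odd x)) (odd x) (begin
    - x                                           ≡⟨ cong -_ (decomposition x) ⟩
    - (+ 2 * half x + bit (odd x))                ≡⟨ negate (half x) (bit (odd x)) ⟩
    + 2 * (- half x - bit (odd x)) + bit (odd x)  ∎))
    where
    negate : ∀ h b → - (+ 2 * h + b) ≡ + 2 * (- h - b) + b
    negate = solve-∀

  odd-- : ∀ x y → odd (x - y) ≡ odd x xor odd y
  odd-- x y = trans (odd-+ x (- y)) (cong (odd x xor_) (odd-neg y))

  odd-+3* : ∀ x y → odd (x + + 3 * y) ≡ odd x xor odd y
  odd-+3* x y = trans (odd-+ x (+ 3 * y)) (cong (odd x xor_) (odd-* (+ 3) y))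

  odd-2* : ∀ k → odd (+ 2 * k) ≡ false
  odd-2* k = trans (cong odd (sym (ℤ.+-identityʳ (+ 2 * k)))) (odd[2k+b]≡b k false)

  half-2* : ∀ k → half (+ 2 * k) ≡ k
  half-2* k = trans (cong half (sym (ℤ.+-identityʳ (+ 2 * k)))) (half[2k+b]≡k k false)

  2*half : ∀ x → odd x ≡ false → + 2 * half x ≡ x
  2*half x x-even = sym (begin
    x                           ≡⟨ decomposition x ⟩
    + 2 * half x + bit (odd x)  ≡⟨ cong (λ b → + 2 * half x + bit b) x-even ⟩
    + 2 * half x + 0ℤ           ≡⟨ ℤ.+-identityʳ _ ⟩
    + 2 * half x                ∎)

  xor-≡ : ∀ {p q} → p ≡ q → p xor q ≡ false
  xor-≡ {p} refl = xor-same p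

open Parity

module EisensteinPairs where

  open import Data.Integer using (_+_; _*_; -_; _-_)
  open import Data.Integer.Tactic.RingSolver using (solve-∀)
  open ≡-Reasoning

  Pair : Set
  Pair = ℤ × ℤ

  norm : Pair → ℤ
  norm (a , b) = a * a + + 3 * (b * b)

  OddPair : Pair → Bool
  OddPair (a , b) = odd a ∧ odd b

  -- Both even, with a ≢ b (mod 4).  Together with the odd pairs these are exactly the pairs
  -- with a² + 3b² ≡ 4 (mod 8).
  EvenPair : Pair → Bool
  EvenPair (a , b) = not (odd a) ∧ not (odd b) ∧ (odd (half a) xor odd (half b))

  -- With α = a + b√-3, this is α ↦ ᾱ · (1 + √-3)/2 on pairs of equal parity: a conjugation
  -- followed by a multiplication by a unit, hence an involution preserving the norm a² + 3b².
  ρ : Pair → Pair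
  ρ (a , b) = half (a + + 3 * b) , half (a - b)

  conj : Pair → Pair
  conj (a , b) = a , - b

  ρ-even : Pair → Bool
  ρ-even p = not (odd (proj₁ (ρ p)))

  halve : ∀ {x k} → x ≡ + 2 * k → half x ≡ k
  halve {k = k} x≡2k = trans (cong half x≡2k) (half-2* k)

  EvenPair⇒even : ∀ a b → T (EvenPair (a , b)) → odd a ≡ false × odd b ≡ false
  EvenPair⇒even a b _ with odd a | odd b
  ... | false | false = refl , refl

  OddPair⇒odd : ∀ a b → T (OddPair (a , b)) → odd a ≡ true × odd b ≡ true
  OddPair⇒odd a b _ with odd a | odd b
  ... | true | true = refl , refl

  EvenPair⇒same-parity : ∀ a b → T (EvenPair (a , b)) → odd a ≡ odd b
  EvenPair⇒same-parity a b ab =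
    let a-even , b-even = EvenPair⇒even a b ab in trans a-even (sym b-even)

  OddPair⇒same-parity : ∀ a b → T (OddPair (a , b)) → odd a ≡ odd b
  OddPair⇒same-parity a b ab =
    let a-odd , b-odd = OddPair⇒odd a b ab in trans a-odd (sym b-odd)

  module _ (a b : ℤ) (same-parity : odd a ≡ odd b) where

    private
      A = proj₁ (ρ (a , b))
      B = proj₂ (ρ (a , b))

      2A : + 2 * A ≡ a + + 3 * b
      2A = 2*half (a + + 3 * b) (trans (odd-+3* a b) (xor-≡ same-parity))

      2B : + 2 * B ≡ a - b
      2B = 2*half (a - b) (trans (odd-- a b) (xor-≡ same-parity))

    ρ-norm : norm (ρ (a , b)) ≡ norm (a , b)
    ρ-norm = ℤ.*-cancelˡ-≡ (+ 4) _ _ (begin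
      + 4 * norm (A , B)                  ≡⟨ scale A B ⟩
      norm (+ 2 * A , + 2 * B)            ≡⟨ cong₂ (λ s t → norm (s , t)) 2A 2B ⟩
      norm (a + + 3 * b , a - b)          ≡⟨ rotate a b ⟩
      + 4 * norm (a , b)                  ∎)
      where
      scale : ∀ A B → + 4 * (A * A + + 3 * (B * B)) ≡
                      (+ 2 * A) * (+ 2 * A) + + 3 * ((+ 2 * B) * (+ 2 * B))
      scale = solve-∀
      rotate : ∀ a b → (a + + 3 * b) * (a + + 3 * b) + + 3 * ((a - b) * (a - b)) ≡
                       + 4 * (a * a + + 3 * (b * b))
      rotate = solve-∀

    ρ-involutive : ρ (ρ (a , b)) ≡ (a , b)
    ρ-involutive = cong₂ _,_
      (halve (ℤ.*-cancelˡ-≡ (+ 2) _ _ (begin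
        + 2 * (A + + 3 * B)           ≡⟨ expand₁ A B ⟩
        + 2 * A + + 3 * (+ 2 * B)     ≡⟨ cong₂ (λ s t → s + + 3 * t) 2A 2B ⟩
        a + + 3 * b + + 3 * (a - b)   ≡⟨ collect₁ a b ⟩
        + 2 * (+ 2 * a)               ∎)))
      (halve (ℤ.*-cancelˡ-≡ (+ 2) _ _ (begin
        + 2 * (A - B)                 ≡⟨ expand₂ A B ⟩
        + 2 * A - + 2 * B             ≡⟨ cong₂ _-_ 2A 2B ⟩
        a + + 3 * b - (a - b)         ≡⟨ collect₂ a b ⟩
        + 2 * (+ 2 * b)               ∎)))
      where
      expand₁ : ∀ A B → + 2 * (A + + 3 * B) ≡ + 2 * A + + 3 * (+ 2 * B)
      expand₁ = solve-∀
      collect₁ : ∀ a b → a + + 3 * b + + 3 * (a - b) ≡ + 2 * (+ 2 * a)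
      collect₁ = solve-∀
      expand₂ : ∀ A B → + 2 * (A - B) ≡ + 2 * A - + 2 * B
      expand₂ = solve-∀
      collect₂ : ∀ a b → a + + 3 * b - (a - b) ≡ + 2 * (+ 2 * b)
      collect₂ = solve-∀

    ρ₂≡ρ₁-2b : B ≡ A - + 2 * b
    ρ₂≡ρ₁-2b = ℤ.*-cancelˡ-≡ (+ 2) _ _ (begin
      + 2 * B                   ≡⟨ 2B ⟩
      a - b                     ≡⟨ shift a b ⟩
      a + + 3 * b - + 4 * b     ≡⟨ cong (_- + 4 * b) 2A ⟨
      + 2 * A - + 4 * b         ≡⟨ expand A b ⟩
      + 2 * (A - + 2 * b)       ∎)
      where
      shift : ∀ a b → a - b ≡ a + + 3 * b - + 4 * b
      shift = solve-∀
      expand : ∀ A b → + 2 * A - + 4 * b ≡ + 2 * (A - + 2 * b)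
      expand = solve-∀

  ρ-of-evens : ∀ A B → ρ (+ 2 * A , + 2 * B) ≡ (A + + 3 * B , A - B)
  ρ-of-evens A B = cong₂ _,_ (halve (factor₁ A B)) (halve (factor₂ A B))
    where
    factor₁ : ∀ A B → + 2 * A + + 3 * (+ 2 * B) ≡ + 2 * (A + + 3 * B)
    factor₁ = solve-∀
    factor₂ : ∀ A B → + 2 * A - + 2 * B ≡ + 2 * (A - B)
    factor₂ = solve-∀

  ρ-on-EvenPair : ∀ a b → odd a ≡ false → odd b ≡ false →
                  OddPair (ρ (a , b)) ∧ ρ-even (ρ (a , b)) ≡ EvenPair (a , b)
  ρ-on-EvenPair a b a-even b-even = begin
    OddPair (ρ (a , b)) ∧ ρ-even (ρ (a , b))
      ≡⟨ cong (λ p → OddPair p ∧ ρ-even p) ρ[a,b] ⟩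
    OddPair (A + + 3 * B , A - B) ∧ not (odd (half (A + + 3 * B + + 3 * (A - B))))
      ≡⟨ cong₂ _∧_ (cong₂ _∧_ (odd-+3* A B) (odd-- A B)) (cong (not ∘ odd) (halve (collect A B))) ⟩
    ((odd A xor odd B) ∧ (odd A xor odd B)) ∧ not (odd (+ 2 * A))
      ≡⟨ cong₂ _∧_ (∧-idem _) (cong not (odd-2* A)) ⟩
    (odd A xor odd B) ∧ true
      ≡⟨ ∧-identityʳ _ ⟩
    odd A xor odd B
      ≡⟨ cong₂ (λ s t → not s ∧ not t ∧ (odd A xor odd B)) a-even b-even ⟨
    EvenPair (a , b) ∎
    where
    A = half a
    B = half b
    ρ[a,b] : ρ (a , b) ≡ (A + + 3 * B , A - B)
    ρ[a,b] = trans (cong₂ (λ s t → ρ (s , t)) (sym (2*half a a-even)) (sym (2*half b b-even)))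
                   (ρ-of-evens A B)
    collect : ∀ A B → A + + 3 * B + + 3 * (A - B) ≡ + 2 * (+ 2 * A)
    collect = solve-∀

  EvenPair-shift : ∀ A b → odd b ≡ true → EvenPair (A , A - + 2 * b) ≡ not (odd A)
  EvenPair-shift A b b-odd with odd A in A-parity
  ... | true = refl
  ... | false = begin
    not (odd (A - + 2 * b)) ∧ (odd α xor odd (half (A - + 2 * b)))
      ≡⟨ cong₂ (λ s t → not s ∧ (odd α xor t)) shifted-even shifted-half ⟩
    odd α xor (odd α xor true)
      ≡⟨ xor-assoc (odd α) (odd α) true ⟨
    (odd α xor odd α) xor true
      ≡⟨ cong (_xor true) (xor-same (odd α)) ⟩
    true ∎
    where
    α = half A
    shifted-even : odd (A - + 2 * b) ≡ false
    shifted-even = trans (odd-- A (+ 2 * b)) (cong₂ _xor_ A-parity (odd-2* b))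
    shifted-half : odd (half (A - + 2 * b)) ≡ odd α xor true
    shifted-half = begin
      odd (half (A - + 2 * b))        ≡⟨ cong (λ t → odd (half (t - + 2 * b))) (2*half A A-parity) ⟨
      odd (half (+ 2 * α - + 2 * b))  ≡⟨ cong odd (halve (factor α b)) ⟩
      odd (α - b)                     ≡⟨ odd-- α b ⟩
      odd α xor odd b                 ≡⟨ cong (odd α xor_) b-odd ⟩
      odd α xor true                  ∎
      where
      factor : ∀ α b → + 2 * α - + 2 * b ≡ + 2 * (α - b)
      factor = solve-∀

  ρ-on-OddPair : ∀ a b → odd a ≡ true → odd b ≡ true → EvenPair (ρ (a , b)) ≡ ρ-even (a , b)
  ρ-on-OddPair a b a-odd b-odd =
    trans (cong (λ t → EvenPair (proj₁ (ρ (a , b)) , t)) (ρ₂≡ρ₁-2b a b (trans a-odd (sym b-odd))))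
          (EvenPair-shift (proj₁ (ρ (a , b))) b b-odd)

  conj-norm : ∀ p → norm (conj p) ≡ norm p
  conj-norm (a , b) = square-neg a b
    where
    square-neg : ∀ a b → a * a + + 3 * (- b * - b) ≡ a * a + + 3 * (b * b)
    square-neg = solve-∀

  conj-involutive : ∀ p → conj (conj p) ≡ p
  conj-involutive (a , b) = cong (a ,_) (ℤ.neg-involutive b)

  conj-flips-ρ-even : ∀ a b → odd a ≡ true → odd b ≡ true → ρ-even (a , - b) ≡ not (ρ-even (a , b))
  conj-flips-ρ-even a b a-odd b-odd = sym (begin
    not (not (odd U))    ≡⟨ not-involutive (odd U) ⟩
    odd U                ≡⟨ cong odd U≡W+3b ⟩
    odd (W + + 3 * b)    ≡⟨ odd-+3* W b ⟩
    odd W xor odd b      ≡⟨ cong (odd W xor_) b-odd ⟩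
    odd W xor true       ≡⟨ trans (xor-comm (odd W) true) (true-xor (odd W)) ⟩
    not (odd W)          ∎)
    where
    U = half (a + + 3 * b)
    W = half (a + + 3 * - b)
    2U : + 2 * U ≡ a + + 3 * b
    2U = 2*half _ (trans (odd-+3* a b) (xor-≡ (trans a-odd (sym b-odd))))
    2W : + 2 * W ≡ a + + 3 * - b
    2W = 2*half _ (trans (odd-+3* a (- b)) (xor-≡ (trans a-odd (sym (trans (odd-neg b) b-odd)))))
    shift : ∀ a b → a + + 3 * b ≡ a + + 3 * - b + + 2 * (+ 3 * b)
    shift = solve-∀
    factor : ∀ W b → + 2 * W + + 2 * (+ 3 * b) ≡ + 2 * (W + + 3 * b)
    factor = solve-∀
    U≡W+3b : U ≡ W + + 3 * b
    U≡W+3b = ℤ.*-cancelˡ-≡ (+ 2) _ _ (begin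
      + 2 * U                           ≡⟨ 2U ⟩
      a + + 3 * b                       ≡⟨ shift a b ⟩
      a + + 3 * - b + + 2 * (+ 3 * b)   ≡⟨ cong (_+ + 2 * (+ 3 * b)) 2W ⟨
      + 2 * W + + 2 * (+ 3 * b)         ≡⟨ factor W b ⟩
      + 2 * (W + + 3 * b)               ∎)

  conj-swaps-ρ-even : ∀ p → OddPair (conj p) ∧ ρ-even (conj p) ≡ OddPair p ∧ not (ρ-even p)
  conj-swaps-ρ-even (a , b) = begin
    (odd a ∧ odd (- b)) ∧ ρ-even (a , - b)
      ≡⟨ cong (λ t → (odd a ∧ t) ∧ ρ-even (a , - b)) (odd-neg b) ⟩
    (odd a ∧ odd b) ∧ ρ-even (a , - b)
      ≡⟨ ∧-cong-when (odd a ∧ odd b) (λ ab → let a-odd , b-odd = OddPair⇒odd a b ab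
                                              in conj-flips-ρ-even a b a-odd b-odd) ⟩
    (odd a ∧ odd b) ∧ not (ρ-even (a , b)) ∎

  record Isometry (X Y : Pair → Bool) : Set where
    field
      bijection : SubsetBijection X Y
      norm-to   : ∀ {p} → T (X p) → norm (SubsetBijection.to bijection p) ≡ norm p
      norm-from : ∀ {q} → T (Y q) → norm (SubsetBijection.from bijection q) ≡ norm q

  ρ-isometry : Isometry EvenPair (λ p → OddPair p ∧ ρ-even p)
  ρ-isometry = record
    { bijection = record
      { to      = ρ
      ; from    = ρ
      ; to∈     = λ {(a , b)} ab → let a-even , b-even = EvenPair⇒even a b ab
                                   in subst T (sym (ρ-on-EvenPair a b a-even b-even)) ab
      ; from∈   = λ {(a , b)} ab∧r → let ab , r = ∧-elim (OddPair (a , b)) ab∧r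
                                         a-odd , b-odd = OddPair⇒odd a b ab
                                     in subst T (sym (ρ-on-OddPair a b a-odd b-odd)) r
      ; from-to = λ {(a , b)} ab → ρ-involutive a b (EvenPair⇒same-parity a b ab)
      ; to-from = λ {(a , b)} ab∧r → ρ-involutive a b (odd-same-parity a b ab∧r)
      }
    ; norm-to   = λ {(a , b)} ab → ρ-norm a b (EvenPair⇒same-parity a b ab)
    ; norm-from = λ {(a , b)} ab∧r → ρ-norm a b (odd-same-parity a b ab∧r)
    }
    where
    odd-same-parity : ∀ a b → T (OddPair (a , b) ∧ ρ-even (a , b)) → odd a ≡ odd b
    odd-same-parity a b = OddPair⇒same-parity a b ∘ proj₁ ∘ ∧-elim (OddPair (a , b))

  conj-isometry : Isometry (λ p → OddPair p ∧ ρ-even p) (λ p → OddPair p ∧ not (ρ-even p))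
  conj-isometry = record
    { bijection = record
      { to      = conj
      ; from    = conj
      ; to∈     = λ {p} → subst T (trans (cong (λ q → OddPair q ∧ ρ-even q)
                                               (sym (conj-involutive p)))
                                         (conj-swaps-ρ-even (conj p)))
      ; from∈   = λ {q} → subst T (sym (conj-swaps-ρ-even q))
      ; from-to = λ {p} _ → conj-involutive p
      ; to-from = λ {q} _ → conj-involutive q
      }
    ; norm-to   = λ {p} _ → conj-norm p
    ; norm-from = λ {q} _ → conj-norm q
    }

open EisensteinPairs

module PairLenses where

  open import Data.Nat using (_+_; _*_)
  open ≡-Reasoning

  record PairLens : Set where
    field
      get     : V → Pair
      put     : Pair → V → V
      get-put : ∀ p v → get (put p v) ≡ p
      put-get : ∀ v → put (get v) v ≡ v
      put-put : ∀ p q v → put p (put q v) ≡ put p v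

  module _ (L : PairLens) (Good : V → Bool)
           (Good-put : ∀ p v → norm p ≡ norm (PairLens.get L v) →
                       Good (PairLens.put L p v) ≡ Good v)
           where

    open PairLens L

    lift-isometry : ∀ {X Y} → Isometry X Y →
                    SubsetBijection (λ v → Good v ∧ X (get v)) (λ v → Good v ∧ Y (get v))
    lift-isometry {X} {Y} ι = record
      { to      = λ v → put (to (get v)) v
      ; from    = λ v → put (from (get v)) v
      ; to∈     = λ {v} v∈ → let Gv , Xv = ∧-elim (Good v) v∈ in
                  ∧-intro (subst T (sym (Good-put _ v (norm-to Xv))) Gv)
                          (subst (T ∘ Y) (sym (get-put _ v)) (to∈ Xv))
      ; from∈   = λ {v} v∈ → let Gv , Yv = ∧-elim (Good v) v∈ in
                  ∧-intro (subst T (sym (Good-put _ v (norm-from Yv))) Gv)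
                          (subst (T ∘ X) (sym (get-put _ v)) (from∈ Yv))
      ; from-to = λ {v} v∈ → round-trip to from (from-to (proj₂ (∧-elim (Good v) v∈)))
      ; to-from = λ {v} v∈ → round-trip from to (to-from (proj₂ (∧-elim (Good v) v∈)))
      }
      where
      open Isometry ι
      open SubsetBijection bijection
      round-trip : ∀ (f g : Pair → Pair) {v} → g (f (get v)) ≡ get v →
                   put (g (get (put (f (get v)) v))) (put (f (get v)) v) ≡ v
      round-trip f g {v} gf≡id = begin
        put (g (get v′)) v′      ≡⟨ cong (λ p → put (g p) v′) (get-put _ v) ⟩
        put (g (f (get v))) v′   ≡⟨ cong (λ p → put p v′) gf≡id ⟩
        put (get v) v′           ≡⟨ put-put _ _ v ⟩
        put (get v) v            ≡⟨ put-get v ⟩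
        v                        ∎
        where v′ = put (f (get v)) v

    module _ (K : ℕ) (Good⊆box : ∀ {v} → T (Good v) → v ∈ box K) where

      count-lift : ∀ {X Y} → Isometry X Y →
                   count (λ v → Good v ∧ X (get v)) (box K) ≡
                   count (λ v → Good v ∧ Y (get v)) (box K)
      count-lift ι = count-bijection (box-unique K) (Good⊆box ∘ proj₁ ∘ ∧-elim _)
                                     (Good⊆box ∘ proj₁ ∘ ∧-elim _) (lift-isometry ι)

      odd-count≡2*even-count : count (λ v → Good v ∧ OddPair (get v)) (box K) ≡
                               2 * count (λ v → Good v ∧ EvenPair (get v)) (box K)
      odd-count≡2*even-count = begin
        count (λ v → Good v ∧ OddPair (get v)) (box K)
          ≡⟨ count-+ (box K) (λ v → split (Good v) (OddPair (get v)) (ρ-even (get v))) ⟩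
        count (λ v → Good v ∧ (OddPair (get v) ∧ ρ-even (get v))) (box K) +
        count (λ v → Good v ∧ (OddPair (get v) ∧ not (ρ-even (get v)))) (box K)
          ≡⟨ cong (_+_ _) (count-lift conj-isometry) ⟨
        count (λ v → Good v ∧ (OddPair (get v) ∧ ρ-even (get v))) (box K) +
        count (λ v → Good v ∧ (OddPair (get v) ∧ ρ-even (get v))) (box K)
          ≡⟨ cong (λ n → n + n) (count-lift ρ-isometry) ⟨
        e + e
          ≡⟨ cong (_+_ e) (ℕ.+-identityʳ e) ⟨
        2 * e ∎
        where
        e = count (λ v → Good v ∧ EvenPair (get v)) (box K)
        split : ∀ g o r → 𝟙 (g ∧ o) ≡ 𝟙 (g ∧ (o ∧ r)) + 𝟙 (g ∧ (o ∧ not r))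
        split false o r = refl
        split true false r = refl
        split true true false = refl
        split true true true = refl

open PairLenses

module Residues where

  open import Data.Integer using (_+_; _*_; _-_)
  open import Data.Integer.Tactic.RingSolver using (solve-∀)
  open ≡-Reasoning

  Digits : Set
  Digits = Bool × Bool

  -- x mod 4, as its two lowest binary digits.
  digits : ℤ → Digits
  digits x = odd x , odd (half x)

  square-residue : Digits → ℤ
  square-residue (true , _) = + 1
  square-residue (false , false) = + 0
  square-residue (false , true) = + 4

  square-of-digits : ∀ p c h → let x = + 2 * (+ 2 * h + bit c) + bit p in
                     ∃[ k ] x * x ≡ + 8 * k + square-residue (p , c)
  square-of-digits false false h = + 2 * (h * h) , expand h
    where
    expand : ∀ h → let x = + 2 * (+ 2 * h + + 0) + + 0 in x * x ≡ + 8 * (+ 2 * (h * h)) + + 0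
    expand = solve-∀
  square-of-digits false true h = + 2 * (h * h) + + 2 * h , expand h
    where
    expand : ∀ h → let x = + 2 * (+ 2 * h + + 1) + + 0 in
             x * x ≡ + 8 * (+ 2 * (h * h) + + 2 * h) + + 4
    expand = solve-∀
  square-of-digits true false h = + 2 * (h * h) + h , expand h
    where
    expand : ∀ h → let x = + 2 * (+ 2 * h + + 0) + + 1 in x * x ≡ + 8 * (+ 2 * (h * h) + h) + + 1
    expand = solve-∀
  square-of-digits true true h = + 2 * (h * h) + + 3 * h + + 1 , expand h
    where
    expand : ∀ h → let x = + 2 * (+ 2 * h + + 1) + + 1 in
             x * x ≡ + 8 * (+ 2 * (h * h) + + 3 * h + + 1) + + 1
    expand = solve-∀

  square-mod8 : ∀ x → ∃[ k ] x * x ≡ + 8 * k + square-residue (digits x)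
  square-mod8 x = subst (λ t → ∃[ k ] t * t ≡ + 8 * k + square-residue (digits x)) (sym x≡)
                        (square-of-digits (odd x) (odd (half x)) (half (half x)))
    where
    x≡ : x ≡ + 2 * (+ 2 * half (half x) + bit (odd (half x))) + bit (odd x)
    x≡ = trans (decomposition x) (cong (λ h → + 2 * h + bit (odd x)) (decomposition (half x)))

  Σ-residue : Digits → Digits → Digits → Digits → ℤ
  Σ-residue dx dy dz dw =
    square-residue dx + square-residue dy + + 3 * square-residue dz + + 9 * square-residue dw

  Q-mod8 : ∀ (v : V) → let (x , y , z , w) = v in
           ∃[ K ] Q 1 1 3 9 v ≡ + 8 * K + Σ-residue (digits x) (digits y) (digits z) (digits w)
  Q-mod8 (x , y , z , w)
    with kx , x² ← square-mod8 x | ky , y² ← square-mod8 y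
       | kz , z² ← square-mod8 z | kw , w² ← square-mod8 w =
    kx + ky + + 3 * kz + + 9 * kw , (begin
      + 1 * (x * x) + + 1 * (y * y) + + 3 * (z * z) + + 9 * (w * w)
        ≡⟨ cong₂ _+_ (cong₂ _+_ (cong₂ _+_ (cong (+ 1 *_) x²) (cong (+ 1 *_) y²))
                                (cong (+ 3 *_) z²))
                     (cong (+ 9 *_) w²) ⟩
      + 1 * (+ 8 * kx + rx) + + 1 * (+ 8 * ky + ry) + + 3 * (+ 8 * kz + rz)
        + + 9 * (+ 8 * kw + rw)
        ≡⟨ collect kx ky kz kw rx ry rz rw ⟩
      + 8 * (kx + ky + + 3 * kz + + 9 * kw) + (rx + ry + + 3 * rz + + 9 * rw) ∎)
    where
    rx = square-residue (digits x)
    ry = square-residue (digits y)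
    rz = square-residue (digits z)
    rw = square-residue (digits w)
    collect : ∀ kx ky kz kw rx ry rz rw →
              + 1 * (+ 8 * kx + rx) + + 1 * (+ 8 * ky + ry) + + 3 * (+ 8 * kz + rz)
                + + 9 * (+ 8 * kw + rw) ≡
              + 8 * (kx + ky + + 3 * kz + + 9 * kw) + (rx + ry + + 3 * rz + + 9 * rw)
    collect = solve-∀

  is6mod8 : ℤ → Bool
  is6mod8 s = not (odd s) ∧ odd (half s) ∧ odd (half (half s))

  is6mod8-8t+6 : ∀ t → is6mod8 (+ 8 * t + + 6) ≡ true
  is6mod8-8t+6 t = begin
    not (odd (+ 8 * t + + 6)) ∧ odd (half (+ 8 * t + + 6)) ∧ odd (half (half (+ 8 * t + + 6)))
      ≡⟨ cong₂ (λ p h → not p ∧ odd h ∧ odd (half h)) (proj₁ first) (proj₂ first) ⟩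
    odd (+ 4 * t + + 3) ∧ odd (half (+ 4 * t + + 3))
      ≡⟨ cong₂ (λ p h → p ∧ odd h) (proj₁ second) (proj₂ second) ⟩
    odd (+ 2 * t + + 1)
      ≡⟨ odd[2k+b]≡b t true ⟩
    true ∎
    where
    split₁ : ∀ t → + 8 * t + + 6 ≡ + 2 * (+ 4 * t + + 3) + + 0
    split₁ = solve-∀
    split₂ : ∀ t → + 4 * t + + 3 ≡ + 2 * (+ 2 * t + + 1) + + 1
    split₂ = solve-∀
    first = odd-half-unique (+ 4 * t + + 3) false (split₁ t)
    second = odd-half-unique (+ 2 * t + + 1) true (split₂ t)

open Residues

module SolutionClasses (n : ℕ) where

  open import Data.Integer using (_+_; _*_; _-_)
  open import Data.Integer.Tactic.RingSolver using (solve-∀)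
  open ≡-Reasoning

  m : ℕ
  m = 8 ℕ.* n ℕ.+ 6

  S₁ S₂ : V → Bool
  S₁ = Sol 1 1 3 9 m
  S₂ = Sol 2 2 3 9 m

  S₁-resp : ∀ v u → Q 1 1 3 9 v ≡ Q 1 1 3 9 u → S₁ v ≡ S₁ u
  S₁-resp = Sol-resp {1} {1} {3} {9} {1} {1} {3} {9} {m}

  S₁⊆box : ∀ {v} → T (S₁ v) → v ∈ box m
  S₁⊆box = solution∈box 0 0 2 8 m

  with₁₃ with₂₃ with₃₄ : (Pair → Bool) → V → Bool
  with₁₃ C (x , y , z , w) = (S₁ (x , y , z , w) ∧ (odd y ∧ odd w)) ∧ C (x , z)
  with₂₃ C (x , y , z , w) = (S₁ (x , y , z , w) ∧ (odd x ∧ odd w)) ∧ C (y , z)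
  with₃₄ C (x , y , z , w) = (S₁ (x , y , z , w) ∧ (odd x ∧ odd y)) ∧ C (z , w)

  I X Y W : V → Bool
  I = with₁₃ OddPair
  X = with₁₃ EvenPair
  Y = with₂₃ EvenPair
  W = with₃₄ EvenPair

  lens₁₃ : PairLens
  lens₁₃ = record
    { get     = λ (x , y , z , w) → x , z
    ; put     = λ (a , b) (x , y , z , w) → a , y , b , w
    ; get-put = λ _ _ → refl
    ; put-get = λ _ → refl
    ; put-put = λ _ _ _ → refl
    }

  lens₃₄ : PairLens
  lens₃₄ = record
    { get     = λ (x , y , z , w) → z , w
    ; put     = λ (a , b) (x , y , z , w) → x , y , a , b
    ; get-put = λ _ _ → refl
    ; put-get = λ _ → refl
    ; put-put = λ _ _ _ → refl
    }

  I≡2*X : count I (box m) ≡ 2 ℕ.* count X (box m)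
  I≡2*X = odd-count≡2*even-count lens₁₃ (λ (x , y , z , w) → S₁ (x , y , z , w) ∧ (odd y ∧ odd w))
                                 norm-invariant m (S₁⊆box ∘ proj₁ ∘ ∧-elim _)
    where
    split : ∀ a b y w → + 1 * (a * a) + + 1 * (y * y) + + 3 * (b * b) + + 9 * (w * w) ≡
                        (a * a + + 3 * (b * b)) + (+ 1 * (y * y) + + 9 * (w * w))
    split = solve-∀
    norm-invariant : ∀ p v → norm p ≡ norm (PairLens.get lens₁₃ v) →
                     let (a , b) = p ; (x , y , z , w) = v in
                     S₁ (a , y , b , w) ∧ (odd y ∧ odd w) ≡ S₁ v ∧ (odd y ∧ odd w)
    norm-invariant (a , b) (x , y , z , w) same-norm =
      cong (_∧ (odd y ∧ odd w))
           (S₁-resp (a , y , b , w) (x , y , z , w)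
                    (trans (split a b y w) (trans (cong (_+ _) same-norm) (sym (split x z y w)))))

  I₃₄≡2*W : count (with₃₄ OddPair) (box m) ≡ 2 ℕ.* count W (box m)
  I₃₄≡2*W = odd-count≡2*even-count lens₃₄ (λ (x , y , z , w) → S₁ (x , y , z , w) ∧ (odd x ∧ odd y))
                                   norm-invariant m (S₁⊆box ∘ proj₁ ∘ ∧-elim _)
    where
    split : ∀ x y a b → + 1 * (x * x) + + 1 * (y * y) + + 3 * (a * a) + + 9 * (b * b) ≡
                        (+ 1 * (x * x) + + 1 * (y * y)) + + 3 * (a * a + + 3 * (b * b))
    split = solve-∀
    norm-invariant : ∀ p v → norm p ≡ norm (PairLens.get lens₃₄ v) →
                     let (a , b) = p ; (x , y , z , w) = v in
                     S₁ (x , y , a , b) ∧ (odd x ∧ odd y) ≡ S₁ v ∧ (odd x ∧ odd y)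
    norm-invariant (a , b) (x , y , z , w) same-norm =
      cong (_∧ (odd x ∧ odd y))
           (S₁-resp (x , y , a , b) (x , y , z , w)
                    (trans (split x y a b)
                           (trans (cong (λ t → + 1 * (x * x) + + 1 * (y * y) + + 3 * t) same-norm)
                                  (sym (split x y z w)))))

  swap₁₂ : V → V
  swap₁₂ (x , y , z , w) = y , x , z , w

  Y∘swap₁₂ : ∀ v → Y (swap₁₂ v) ≡ X v
  Y∘swap₁₂ v@(x , y , z , w) =
    cong (λ s → (s ∧ (odd y ∧ odd w)) ∧ EvenPair (x , z)) (S₁-resp (swap₁₂ v) v (commute x y z w))
    where
    commute : ∀ x y z w → + 1 * (y * y) + + 1 * (x * x) + + 3 * (z * z) + + 9 * (w * w) ≡
                          + 1 * (x * x) + + 1 * (y * y) + + 3 * (z * z) + + 9 * (w * w)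
    commute = solve-∀

  swap-bijection : SubsetBijection X Y
  swap-bijection = record
    { to      = swap₁₂
    ; from    = swap₁₂
    ; to∈     = λ {v} → subst T (sym (Y∘swap₁₂ v))
    ; from∈   = λ {u} → subst T (Y∘swap₁₂ (swap₁₂ u))
    ; from-to = λ _ → refl
    ; to-from = λ _ → refl
    }

  same-parity₁₂ : V → Bool
  same-parity₁₂ (x , y , _ , _) = not (odd x xor odd y)

  sum-difference : V → V
  sum-difference (x , y , z , w) = x + y , x - y , z , w

  halve-sum-difference : V → V
  halve-sum-difference (x , y , z , w) = half (x + y) , half (x - y) , z , w

  S₁∘sum-difference : ∀ v → S₁ (sum-difference v) ≡ S₂ v
  S₁∘sum-difference v@(x , y , z , w) =
    Sol-resp {1} {1} {3} {9} {2} {2} {3} {9} {m} (sum-difference v) v (expand x y z w)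
    where
    expand : ∀ x y z w →
             + 1 * ((x + y) * (x + y)) + + 1 * ((x - y) * (x - y)) + + 3 * (z * z) + + 9 * (w * w) ≡
             + 2 * (x * x) + + 2 * (y * y) + + 3 * (z * z) + + 9 * (w * w)
    expand = solve-∀

  halve∘sum-difference : ∀ v → halve-sum-difference (sum-difference v) ≡ v
  halve∘sum-difference (x , y , z , w) =
    cong₂ (λ a b → a , b , z , w) (halve (double-x x y)) (halve (double-y x y))
    where
    double-x : ∀ x y → (x + y) + (x - y) ≡ + 2 * x
    double-x = solve-∀
    double-y : ∀ x y → (x + y) - (x - y) ≡ + 2 * y
    double-y = solve-∀

  sum-difference∘halve : ∀ (v : V) → let (x , y , _ , _) = v in odd x ≡ odd y →
                         sum-difference (halve-sum-difference v) ≡ v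
  sum-difference∘halve (x , y , z , w) same =
    cong₂ (λ a b → a , b , z , w)
      (ℤ.*-cancelˡ-≡ (+ 2) _ _ (begin
        + 2 * (h₊ + h₋)       ≡⟨ distribute₊ h₊ h₋ ⟩
        + 2 * h₊ + + 2 * h₋   ≡⟨ cong₂ _+_ 2h₊ 2h₋ ⟩
        (x + y) + (x - y)     ≡⟨ collect₊ x y ⟩
        + 2 * x               ∎))
      (ℤ.*-cancelˡ-≡ (+ 2) _ _ (begin
        + 2 * (h₊ - h₋)       ≡⟨ distribute₋ h₊ h₋ ⟩
        + 2 * h₊ - + 2 * h₋   ≡⟨ cong₂ _-_ 2h₊ 2h₋ ⟩
        (x + y) - (x - y)     ≡⟨ collect₋ x y ⟩
        + 2 * y               ∎))
    where
    h₊ = half (x + y)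
    h₋ = half (x - y)
    2h₊ : + 2 * h₊ ≡ x + y
    2h₊ = 2*half (x + y) (trans (odd-+ x y) (xor-≡ same))
    2h₋ : + 2 * h₋ ≡ x - y
    2h₋ = 2*half (x - y) (trans (odd-- x y) (xor-≡ same))
    distribute₊ : ∀ a b → + 2 * (a + b) ≡ + 2 * a + + 2 * b
    distribute₊ = solve-∀
    distribute₋ : ∀ a b → + 2 * (a - b) ≡ + 2 * a - + 2 * b
    distribute₋ = solve-∀
    collect₊ : ∀ x y → (x + y) + (x - y) ≡ + 2 * x
    collect₊ = solve-∀
    collect₋ : ∀ x y → (x + y) - (x - y) ≡ + 2 * y
    collect₋ = solve-∀

  sum-difference-bijection : SubsetBijection S₂ (λ v → S₁ v ∧ same-parity₁₂ v)
  sum-difference-bijection = record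
    { to      = sum-difference
    ; from    = halve-sum-difference
    ; to∈     = λ {v} v∈ → ∧-intro (subst T (sym (S₁∘sum-difference v)) v∈)
                                   (sum-difference-same-parity v)
    ; from∈   = λ {u} u∈ → let u-sol , u-same = ∧-elim (S₁ u) u∈ in
                subst T (trans (cong S₁ (sym (sum-difference∘halve u (same-parity u u-same))))
                               (S₁∘sum-difference (halve-sum-difference u))) u-sol
    ; from-to = λ {v} _ → halve∘sum-difference v
    ; to-from = λ {u} u∈ → sum-difference∘halve u (same-parity u (proj₂ (∧-elim (S₁ u) u∈)))
    }
    where
    sum-difference-same-parity : ∀ v → T (same-parity₁₂ (sum-difference v))
    sum-difference-same-parity (x , y , _ , _) =
      subst (T ∘ not) (sym (xor-≡ (trans (odd-+ x y) (sym (odd-- x y))))) _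
    same-parity : ∀ u → T (same-parity₁₂ u) → let (x , y , _ , _) = u in odd x ≡ odd y
    same-parity (x , y , _ , _) _ with odd x | odd y
    ... | false | false = refl
    ... | true | true = refl

  solution-is6mod8 : ∀ (v : V) → let (x , y , z , w) = v in
                     T (S₁ v) → T (is6mod8 (Σ-residue (digits x) (digits y) (digits z) (digits w)))
  solution-is6mod8 v@(x , y , z , w) sol =
    subst (T ∘ is6mod8) (sym r≡8t+6) (subst T (sym (is6mod8-8t+6 (+ n - K))) _)
    where
    r = Σ-residue (digits x) (digits y) (digits z) (digits w)
    K = proj₁ (Q-mod8 v)
    cancel : ∀ K r → r ≡ (+ 8 * K + r) - + 8 * K
    cancel = solve-∀
    regroup : ∀ n K → (+ 8 * n + + 6) - + 8 * K ≡ + 8 * (n - K) + + 6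
    regroup = solve-∀
    r≡8t+6 : r ≡ + 8 * (+ n - K) + + 6
    r≡8t+6 = begin
      r                             ≡⟨ cancel K r ⟩
      (+ 8 * K + r) - + 8 * K       ≡⟨ cong (_- + 8 * K) (proj₂ (Q-mod8 v)) ⟨
      Q 1 1 3 9 v - + 8 * K         ≡⟨ cong (_- + 8 * K) (Sol⇒Q {1} {1} {3} {9} {m} v sol) ⟩
      + m - + 8 * K                 ≡⟨⟩
      + (8 ℕ.* n ℕ.+ 6) - + 8 * K   ≡⟨ cong (_- + 8 * K) (trans (ℤ.pos-+ (8 ℕ.* n) 6)
                                                                 (cong (_+ + 6) (ℤ.pos-* 8 n))) ⟩
      (+ 8 * + n + + 6) - + 8 * K   ≡⟨ regroup (+ n) K ⟩
      + 8 * (+ n - K) + + 6         ∎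

module ResidueCheck where

  open import Data.Nat using (_+_; _≡ᵇ_)

  both : (Bool → Bool) → Bool
  both f = f false ∧ f true

  both-sound : ∀ f → T (both f) → ∀ b → T (f b)
  both-sound f t false = proj₁ (∧-elim (f false) t)
  both-sound f t true = proj₂ (∧-elim (f false) t)

  every : (Digits → Bool) → Bool
  every f = both λ p → both λ h → f (p , h)

  every-sound : ∀ f → T (every f) → ∀ d → T (f d)
  every-sound f t (p , h) =
    both-sound (λ h → f (p , h)) (both-sound (λ p → both λ h → f (p , h)) t p) h

  -- The classes of SolutionClasses at a point whose membership in S₁ is s and whose
  -- coordinates are ≡ dx, dy, dz, dw (mod 4).
  module _ (s : Bool) (dx dy dz dw : Digits) where

    private
      even : Digits → Digits → Bool
      even (p , h) (q , k) = not p ∧ not q ∧ (h xor k)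
      i = (s ∧ (proj₁ dy ∧ proj₁ dw)) ∧ (proj₁ dx ∧ proj₁ dz)
      i₃₄ = (s ∧ (proj₁ dx ∧ proj₁ dy)) ∧ (proj₁ dz ∧ proj₁ dw)
      x = (s ∧ (proj₁ dy ∧ proj₁ dw)) ∧ even dx dz
      y = (s ∧ (proj₁ dx ∧ proj₁ dw)) ∧ even dy dz
      w = (s ∧ (proj₁ dx ∧ proj₁ dy)) ∧ even dz dw

    Partition SameParityPartition OddClassesAgree Identities : Bool
    Partition = 𝟙 s ≡ᵇ 𝟙 i + 𝟙 x + 𝟙 y + 𝟙 w
    SameParityPartition = 𝟙 (s ∧ not (proj₁ dx xor proj₁ dy)) ≡ᵇ 𝟙 i + 𝟙 w
    OddClassesAgree = 𝟙 i₃₄ ≡ᵇ 𝟙 i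
    Identities = Partition ∧ SameParityPartition ∧ OddClassesAgree

  Checked : Digits → Digits → Digits → Digits → Bool
  Checked dx dy dz dw = not (is6mod8 (Σ-residue dx dy dz dw)) ∨ Identities true dx dy dz dw

  -- Evaluates all 4⁴ residue patterns.
  checked : ∀ dx dy dz dw → T (Checked dx dy dz dw)
  checked dx dy dz dw =
    every-sound (Checked dx dy dz)
      (every-sound (λ dz → every (Checked dx dy dz))
        (every-sound (λ dy → every λ dz → every (Checked dx dy dz))
          (every-sound (λ dx → every λ dy → every λ dz → every (Checked dx dy dz)) _ dx) dy) dz) dw

  identities : ∀ s dx dy dz dw → (T s → T (is6mod8 (Σ-residue dx dy dz dw))) →
               T (Identities s dx dy dz dw)
  identities false _ _ _ _ _ = _
  identities true dx dy dz dw is6 = resolve (is6 _) (checked dx dy dz dw)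
    where
    resolve : ∀ {r i} → T r → T (not r ∨ i) → T i
    resolve {true} _ t = t

open ResidueCheck

open import Data.Nat using (_+_; _*_; _<_)

module ClassCounts (n : ℕ) where

  open SolutionClasses n public
  open ≡-Reasoning

  c : (V → Bool) → ℕ
  c P = count P (box m)

  module _ (v : V) where

    private
      dx = digits (proj₁ v)
      dy = digits (proj₁ (proj₂ v))
      dz = digits (proj₁ (proj₂ (proj₂ v)))
      dw = digits (proj₂ (proj₂ (proj₂ v)))
      all-hold : T (Identities (S₁ v) dx dy dz dw)
      all-hold = identities (S₁ v) dx dy dz dw (solution-is6mod8 v)
      last-hold : T (SameParityPartition (S₁ v) dx dy dz dw ∧ OddClassesAgree (S₁ v) dx dy dz dw)
      last-hold = proj₂ (∧-elim (Partition (S₁ v) dx dy dz dw) all-hold)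

    partition : 𝟙 (S₁ v) ≡ 𝟙 (I v) + 𝟙 (X v) + 𝟙 (Y v) + 𝟙 (W v)
    partition = ℕ.≡ᵇ⇒≡ _ _ (proj₁ (∧-elim (Partition (S₁ v) dx dy dz dw) all-hold))

    same-parity-partition : 𝟙 (S₁ v ∧ same-parity₁₂ v) ≡ 𝟙 (I v) + 𝟙 (W v)
    same-parity-partition =
      ℕ.≡ᵇ⇒≡ _ _ (proj₁ (∧-elim (SameParityPartition (S₁ v) dx dy dz dw) last-hold))

    odd-classes-agree : 𝟙 (with₃₄ OddPair v) ≡ 𝟙 (I v)
    odd-classes-agree =
      ℕ.≡ᵇ⇒≡ _ _ (proj₂ (∧-elim (SameParityPartition (S₁ v) dx dy dz dw) last-hold))

  N₁≡I+X+Y+W : N 1 1 3 9 m ≡ c I + c X + c Y + c W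
  N₁≡I+X+Y+W = begin
    N 1 1 3 9 m
      ≡⟨ N≡count 1 1 3 9 m ⟩
    c S₁
      ≡⟨ ∑-cong (box m) partition ⟩
    ∑[ v ∈ box m ] (𝟙 (I v) + 𝟙 (X v) + 𝟙 (Y v) + 𝟙 (W v))
      ≡⟨ ∑-+ (box m) _ _ ⟩
    ∑[ v ∈ box m ] (𝟙 (I v) + 𝟙 (X v) + 𝟙 (Y v)) + c W
      ≡⟨ cong (_+ c W) (∑-+ (box m) _ _) ⟩
    ∑[ v ∈ box m ] (𝟙 (I v) + 𝟙 (X v)) + c Y + c W
      ≡⟨ cong (λ t → t + c Y + c W) (∑-+ (box m) _ _) ⟩
    c I + c X + c Y + c W ∎

  N₂≡I+W : N 2 2 3 9 m ≡ c I + c W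
  N₂≡I+W = begin
    N 2 2 3 9 m                       ≡⟨ N≡count 2 2 3 9 m ⟩
    c S₂                              ≡⟨ count-bijection (box-unique m) (solution∈box 1 1 2 8 m)
                                           (S₁⊆box ∘ proj₁ ∘ ∧-elim _) sum-difference-bijection ⟩
    c (λ v → S₁ v ∧ same-parity₁₂ v)  ≡⟨ count-+ (box m) same-parity-partition ⟩
    c I + c W                         ∎

  I≡2*W : c I ≡ 2 * c W
  I≡2*W = trans (sym (count-cong (box m) odd-classes-agree)) I₃₄≡2*W

  X≡Y : c X ≡ c Y
  X≡Y = count-bijection (box-unique m) (S₁⊆box ∘ proj₁ ∘ ∧-elim _ ∘ proj₁ ∘ ∧-elim _)
                        (S₁⊆box ∘ proj₁ ∘ ∧-elim _ ∘ proj₁ ∘ ∧-elim _) swap-bijection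

five-thirds : ∀ {i x y w} → i ≡ 2 * x → i ≡ 2 * w → x ≡ y → 5 * (i + w) ≡ 3 * (i + x + y + w)
five-thirds {x = x} {w = w} refl 2x≡2w refl with refl ← ℕ.*-cancelˡ-≡ x w 2 2x≡2w = identity x
  where
  open import Data.Nat.Tactic.RingSolver using (solve-∀)
  identity : ∀ x → 5 * (2 * x + x) ≡ 3 * (2 * x + x + x + x)
  identity = solve-∀

corollary2p1 : (n : ℕ) → 0 < n →
    5 * N 2 2 3 9 (8 * n + 6) ≡ 3 * N 1 1 3 9 (8 * n + 6)
corollary2p1 n _ = begin
  5 * N 2 2 3 9 (8 * n + 6)   ≡⟨ cong (5 *_) N₂≡I+W ⟩
  5 * (c I + c W)             ≡⟨ five-thirds I≡2*X I≡2*W X≡Y ⟩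
  3 * (c I + c X + c Y + c W) ≡⟨ cong (3 *_) N₁≡I+X+Y+W ⟨
  3 * N 1 1 3 9 (8 * n + 6)   ∎
  where
  open ClassCounts n
  open ≡-Reasoning
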